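{- For every non-negative integer $L$, \[ \sum_{j=-\infty}^{\infty} (-1)^j q^{j^2} \left(\frac{j+1}{3}\right) {2L\brack L+j}_{q^2}=\frac{(q^3;q^6)_L}{(q;q^2)_L}. \]
   Context: $(a;q)_n=(1-a)(1-aq)\cdots(1-aq^{n-1})$ (with $(a;q)_0=1$). For integers $M,k$, ${M\brack k}_{q^2}=\frac{(q^2;q^2)_M}{(q^2;q^2)_k(q^2;q^2)_{M-k}}$ if $0\le k\le M$ and $0$ otherwise. $\left(\frac{j}{3}\right)$ is the Legendre symbol modulo $3$: $1$ if $j\equiv 1\pmod 3$, $-1$ if $j\equiv -1\pmod 3$, $0$ if $3\mid j$. -}

module Defs where

open import Data.Nat as ℕ using (ℕ; zero; suc)
open import Data.Integer as ℤ using (ℤ; +_; -[1+_])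
open import Data.Integer.DivMod using (_%ℕ_)
open import Data.Rational as ℚ using (ℚ; 0ℚ; 1ℚ; _+_; _*_; _-_; -_; _≟_)
open import Data.List using (List; map; foldr; upTo)
open import Relation.Nullary using (yes; no)

_^_ : ℚ → ℕ → ℚ
x ^ zero = 1ℚ
x ^ suc n = (x ^ n) * x

-- total inverse (0 ↦ 0); only ever applied to nonzero values below
inv : ℚ → ℚ
inv x with x ≟ 0ℚ
... | yes _ = 0ℚ
... | no x≢0 = ℚ.1/_ x {{ℚ.≢-nonZero x≢0}}

poch : ℚ → ℚ → ℕ → ℚ
poch a q zero = 1ℚ
poch a q (suc n) = poch a q n * (1ℚ - a * (q ^ n))

qbin2 : ℚ → ℕ → ℤ → ℚ
qbin2 q M -[1+ _ ] = 0ℚ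
qbin2 q M (+ k) with k ℕ.≤? M
... | yes _ = poch (q ^ 2) (q ^ 2) M
              * inv (poch (q ^ 2) (q ^ 2) k * poch (q ^ 2) (q ^ 2) (M ℕ.∸ k))
... | no _ = 0ℚ

leg3 : ℤ → ℚ
leg3 j with j %ℕ 3
... | 1 = 1ℚ
... | 2 = - 1ℚ
... | _ = 0ℚ

sumSym : ℕ → (ℤ → ℚ) → ℚ
sumSym L f = foldr (λ i acc → f (ℤ.- (+ L) ℤ.+ + i) + acc) 0ℚ (upTo (suc (2 ℕ.* L)))

term : ℚ → ℕ → ℤ → ℚ
term q L j = ((- 1ℚ) ^ ℤ.∣ j ∣) * (q ^ (ℤ.∣ j ∣ ℕ.* ℤ.∣ j ∣))
             * leg3 (j ℤ.+ + 1) * qbin2 q (2 ℕ.* L) (+ L ℤ.+ j)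

module Submission where

-- With x i = q^(2i+1), the summand θ L k = (-1)^(k-L) q^((k-L)²) [2L, k]_{q²} is the coefficient
-- of z^(k-L) in the finite Jacobi triple product ∏_{i<L} (1 - x i z)(1 - x i / z).  All we use is
-- the resulting recurrence θ (L+1) = (-x + (1 + x²) z - x z²) · θ L (with x = x L), which follows
-- from a two-step q-Pascal rule.  Pairing with the period-3 character χ(k+1) amounts to evaluating
-- at a primitive cube root of unity ω, where (1 - x ω)(1 - x ω²) = 1 + x + x² = (1 - x³)/(1 - x);
-- the product of these factors over i < L is (q³;q⁶)_L / (q;q²)_L.

open import Defs
open import Level using (0ℓ)
open import Data.Nat as ℕ using (ℕ; zero; suc; ∣_-_∣)
open import Data.Integer as ℤ using (ℤ; -[1+_]; _⊖_)
import Data.Nat.Properties as ℕP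
import Data.Nat.Tactic.RingSolver as ℕS
import Data.Nat.DivMod as ℕD
open import Data.Integer.DivMod using (_%ℕ_)
import Data.Integer.Properties as ℤP
open import Data.Rational as ℚ using (ℚ; 0ℚ; 1ℚ; _+_; _*_; _-_; -_; _≟_)
import Data.Rational.Properties as ℚP
open import Data.List using (foldr; applyUpTo)
open import Data.Maybe using (Maybe; just; nothing)
open import Data.Empty using (⊥-elim)
open import Data.Sum using (inj₁; inj₂)
open import Relation.Binary.Definitions using (tri<; tri≈; tri>)
open import Relation.Binary.PropositionalEquality
open import Relation.Nullary using (yes; no)
open import Function using (_∘_)
open import Tactic.RingSolver using (solve-∀)
open import Tactic.RingSolver.Core.AlmostCommutativeRing
  using (AlmostCommutativeRing; fromCommutativeRing)
open ≡-Reasoning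
import Algebra.Properties.Group ℚP.+-0-group as +-Group

ℚ-ring : AlmostCommutativeRing 0ℓ 0ℓ
ℚ-ring = fromCommutativeRing ℚP.+-*-commutativeRing isZero
  where
  isZero : ∀ x → Maybe (0ℚ ≡ x)
  isZero x with 0ℚ ≟ x
  ... | yes p = just p
  ... | no _ = nothing

^-distribˡ-+-* : ∀ x m n → x ^ (m ℕ.+ n) ≡ x ^ m * x ^ n
^-distribˡ-+-* x m zero = trans (cong (x ^_) (ℕP.+-identityʳ m)) (sym (ℚP.*-identityʳ (x ^ m)))
^-distribˡ-+-* x m (suc n) = begin
  x ^ (m ℕ.+ suc n)   ≡⟨ cong (x ^_) (ℕP.+-suc m n) ⟩
  x ^ (m ℕ.+ n) * x   ≡⟨ cong (_* x) (^-distribˡ-+-* x m n) ⟩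
  x ^ m * x ^ n * x   ≡⟨ ℚP.*-assoc (x ^ m) (x ^ n) x ⟩
  x ^ m * x ^ suc n   ∎

^-*-assoc : ∀ x m n → (x ^ m) ^ n ≡ x ^ (m ℕ.* n)
^-*-assoc x m zero = cong (x ^_) (sym (ℕP.*-zeroʳ m))
^-*-assoc x m (suc n) = begin
  (x ^ m) ^ n * x ^ m      ≡⟨ cong (_* x ^ m) (^-*-assoc x m n) ⟩
  x ^ (m ℕ.* n) * x ^ m    ≡⟨ ℚP.*-comm (x ^ (m ℕ.* n)) (x ^ m) ⟩
  x ^ m * x ^ (m ℕ.* n)    ≡⟨ ^-distribˡ-+-* x m (m ℕ.* n) ⟨
  x ^ (m ℕ.+ m ℕ.* n)      ≡⟨ cong (x ^_) (ℕP.*-suc m n) ⟨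
  x ^ (m ℕ.* suc n)        ∎

∣x^n∣≡∣x∣^n : ∀ x n → ℚ.∣ x ^ n ∣ ≡ ℚ.∣ x ∣ ^ n
∣x^n∣≡∣x∣^n x zero = refl
∣x^n∣≡∣x∣^n x (suc n) = trans (ℚP.∣p*q∣≡∣p∣*∣q∣ (x ^ n) x) (cong (_* ℚ.∣ x ∣) (∣x^n∣≡∣x∣^n x n))

module _ (a : ℚ) .{{_ : ℚ.NonNegative a}} where

  a≤1⇒a^n≤1 : a ℚ.≤ 1ℚ → ∀ n → a ^ n ℚ.≤ 1ℚ
  a≤1⇒a^n≤1 a≤1 zero = ℚP.≤-refl
  a≤1⇒a^n≤1 a≤1 (suc n) = ℚP.≤-trans (ℚP.*-monoʳ-≤-nonNeg a (a≤1⇒a^n≤1 a≤1 n))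
    (ℚP.≤-trans (ℚP.≤-reflexive (ℚP.*-identityˡ a)) a≤1)

  1≤a⇒1≤a^n : 1ℚ ℚ.≤ a → ∀ n → 1ℚ ℚ.≤ a ^ n
  1≤a⇒1≤a^n 1≤a zero = ℚP.≤-refl
  1≤a⇒1≤a^n 1≤a (suc n) = ℚP.≤-trans 1≤a
    (ℚP.≤-trans (ℚP.≤-reflexive (sym (ℚP.*-identityˡ a))) (ℚP.*-monoʳ-≤-nonNeg a (1≤a⇒1≤a^n 1≤a n)))

  a<1⇒a^[1+n]<1 : a ℚ.< 1ℚ → ∀ n → a ^ suc n ℚ.< 1ℚ
  a<1⇒a^[1+n]<1 a<1 n = ℚP.≤-<-trans (ℚP.*-monoʳ-≤-nonNeg a (a≤1⇒a^n≤1 (ℚP.<⇒≤ a<1) n))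
    (ℚP.≤-<-trans (ℚP.≤-reflexive (ℚP.*-identityˡ a)) a<1)

  1<a⇒1<a^[1+n] : 1ℚ ℚ.< a → ∀ n → 1ℚ ℚ.< a ^ suc n
  1<a⇒1<a^[1+n] 1<a n = ℚP.<-≤-trans 1<a
    (ℚP.≤-trans (ℚP.≤-reflexive (sym (ℚP.*-identityˡ a))) (ℚP.*-monoʳ-≤-nonNeg a (1≤a⇒1≤a^n (ℚP.<⇒≤ 1<a) n)))

x^[1+n]≢1 : ∀ {x} → x ≢ 1ℚ → x ≢ - 1ℚ → ∀ n → x ^ suc n ≢ 1ℚ
x^[1+n]≢1 {x} x≢1 x≢-1 n x^[1+n]≡1 with ℚP.<-cmp ℚ.∣ x ∣ 1ℚ
... | tri< ∣x∣<1 _ _ = ℚP.<-irrefl ∣x∣^[1+n]≡1 (a<1⇒a^[1+n]<1 ℚ.∣ x ∣ {{ℚP.∣-∣-nonNeg x}} ∣x∣<1 n)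
  where ∣x∣^[1+n]≡1 = trans (sym (∣x^n∣≡∣x∣^n x (suc n))) (cong ℚ.∣_∣ x^[1+n]≡1)
... | tri> _ _ 1<∣x∣ = ℚP.<-irrefl (sym ∣x∣^[1+n]≡1) (1<a⇒1<a^[1+n] ℚ.∣ x ∣ {{ℚP.∣-∣-nonNeg x}} 1<∣x∣ n)
  where ∣x∣^[1+n]≡1 = trans (sym (∣x^n∣≡∣x∣^n x (suc n))) (cong ℚ.∣_∣ x^[1+n]≡1)
... | tri≈ _ ∣x∣≡1 _ with ℚP.∣p∣≡p∨∣p∣≡-p x
...   | inj₁ ∣x∣≡x = x≢1 (trans (sym ∣x∣≡x) ∣x∣≡1)
...   | inj₂ ∣x∣≡-x = x≢-1 (ℚP.neg-injective (trans (sym ∣x∣≡-x) ∣x∣≡1))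

x*inv[x]≡1 : ∀ {x} → x ≢ 0ℚ → x * inv x ≡ 1ℚ
x*inv[x]≡1 {x} x≢0 with x ≟ 0ℚ
... | yes x≡0 = ⊥-elim (x≢0 x≡0)
... | no x≢0′ = ℚP.*-inverseʳ x {{ℚ.≢-nonZero x≢0′}}

*-cancelˡ-≢0 : ∀ {d a b} → d ≢ 0ℚ → d * a ≡ d * b → a ≡ b
*-cancelˡ-≢0 {d} {a} {b} d≢0 da≡db = begin
  a                ≡⟨ undo a ⟩
  inv d * (d * a)  ≡⟨ cong (inv d *_) da≡db ⟩
  inv d * (d * b)  ≡⟨ undo b ⟨
  b                ∎
  where
  reassoc : ∀ x y z → x * y * z ≡ y * (x * z)
  reassoc = solve-∀ ℚ-ring
  undo : ∀ c → c ≡ inv d * (d * c)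
  undo c = begin
    c                ≡⟨ ℚP.*-identityˡ c ⟨
    1ℚ * c           ≡⟨ cong (_* c) (x*inv[x]≡1 d≢0) ⟨
    d * inv d * c    ≡⟨ reassoc d (inv d) c ⟩
    inv d * (d * c)  ∎

*-≢0 : ∀ {a b} → a ≢ 0ℚ → b ≢ 0ℚ → a * b ≢ 0ℚ
*-≢0 {a} a≢0 b≢0 ab≡0 = b≢0 (*-cancelˡ-≢0 a≢0 (trans ab≡0 (sym (ℚP.*-zeroʳ a))))

poch-≢0 : ∀ a r → (∀ n → a * r ^ n ≢ 1ℚ) → ∀ n → poch a r n ≢ 0ℚ
poch-≢0 a r ar^n≢1 zero ()
poch-≢0 a r ar^n≢1 (suc n) = *-≢0 (poch-≢0 a r ar^n≢1 n) 1-ar^n≢0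
  where
  1-ar^n≢0 : 1ℚ - a * r ^ n ≢ 0ℚ
  1-ar^n≢0 e = ar^n≢1 n (sym (+-Group.x∙y⁻¹≈ε⇒x≈y 1ℚ (a * r ^ n) e))

Σ< : ℕ → (ℕ → ℚ) → ℚ
Σ< zero f = 0ℚ
Σ< (suc n) f = Σ< n f + f n

Σ<-cong : ∀ n {f g : ℕ → ℚ} → (∀ k → f k ≡ g k) → Σ< n f ≡ Σ< n g
Σ<-cong zero f≡g = refl
Σ<-cong (suc n) f≡g = cong₂ _+_ (Σ<-cong n f≡g) (f≡g n)

Σ<-vanishing-tail : ∀ n f → (∀ k → n ℕ.≤ k → f k ≡ 0ℚ) → ∀ e → Σ< (e ℕ.+ n) f ≡ Σ< n f
Σ<-vanishing-tail n f tail≡0 zero = refl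
Σ<-vanishing-tail n f tail≡0 (suc e) = begin
  Σ< (e ℕ.+ n) f + f (e ℕ.+ n)  ≡⟨ cong₂ _+_ (Σ<-vanishing-tail n f tail≡0 e) (tail≡0 (e ℕ.+ n) (ℕP.m≤n+m n e)) ⟩
  Σ< n f + 0ℚ                   ≡⟨ ℚP.+-identityʳ (Σ< n f) ⟩
  Σ< n f                        ∎

Σ<-head : ∀ n f → Σ< (suc n) f ≡ f 0 + Σ< n (λ k → f (suc k))
Σ<-head zero f = trans (ℚP.+-identityˡ (f 0)) (sym (ℚP.+-identityʳ (f 0)))
Σ<-head (suc n) f = trans (cong (_+ f (suc n)) (Σ<-head n f)) (ℚP.+-assoc (f 0) _ _)

foldr-applyUpTo≡Σ< : ∀ n (f : ℕ → ℚ) g →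
  foldr (λ i acc → f i + acc) 0ℚ (applyUpTo g n) ≡ Σ< n (λ k → f (g k))
foldr-applyUpTo≡Σ< zero f g = refl
foldr-applyUpTo≡Σ< (suc n) f g = begin
  f (g 0) + foldr (λ i acc → f i + acc) 0ℚ (applyUpTo (λ k → g (suc k)) n)
    ≡⟨ cong (f (g 0) +_) (foldr-applyUpTo≡Σ< n f (λ k → g (suc k))) ⟩
  f (g 0) + Σ< n (λ k → f (g (suc k)))
    ≡⟨ Σ<-head n (λ k → f (g k)) ⟨
  Σ< (suc n) (λ k → f (g k)) ∎

-- Coefficients of (α + β z + α z²) · Σ f k zᵏ.
conv3 : ℚ → ℚ → (ℕ → ℚ) → ℕ → ℚ
conv3 α β f zero = α * f 0
conv3 α β f (suc zero) = α * f 1 + β * f 0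
conv3 α β f (suc (suc k)) = α * f (suc (suc k)) + β * f (suc k) + α * f k

Σ<-conv3 : ∀ α β (f c : ℕ → ℚ) n →
  Σ< (suc (suc n)) (λ k → conv3 α β f k * c k)
    ≡ α * Σ< (suc (suc n)) (λ k → f k * c k) + β * Σ< (suc n) (λ k → f k * c (suc k))
      + α * Σ< n (λ k → f k * c (suc (suc k)))
Σ<-conv3 α β f c zero = expand α β (f 0) (f 1) (c 0) (c 1)
  where
  expand : ∀ α β f₀ f₁ c₀ c₁ →
    0ℚ + α * f₀ * c₀ + (α * f₁ + β * f₀) * c₁
      ≡ α * (0ℚ + f₀ * c₀ + f₁ * c₁) + β * (0ℚ + f₀ * c₁) + α * 0ℚ
  expand = solve-∀ ℚ-ring
Σ<-conv3 α β f c (suc n) =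
  trans (cong (_+ conv3 α β f (suc (suc n)) * c (suc (suc n))) (Σ<-conv3 α β f c n))
        (expand α β _ _ _ (f (suc (suc n))) (f (suc n)) (f n) (c (suc (suc n))))
  where
  expand : ∀ α β S₂ S₁ S₀ f₂ f₁ f₀ c →
    α * S₂ + β * S₁ + α * S₀ + (α * f₂ + β * f₁ + α * f₀) * c
      ≡ α * (S₂ + f₂ * c) + β * (S₁ + f₁ * c) + α * (S₀ + f₀ * c)
  expand = solve-∀ ℚ-ring

gauss : ℚ → ℕ → ℕ → ℚ
gauss Q n k with k ℕ.≤? n
... | yes _ = poch Q Q n * inv (poch Q Q k * poch Q Q (n ℕ.∸ k))
... | no _ = 0ℚ

qbin2≡gauss : ∀ q n k → qbin2 q n (ℤ.+ k) ≡ gauss (q ^ 2) n k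
qbin2≡gauss q n k with k ℕ.≤? n
... | yes _ = refl
... | no _ = refl

module Gaussian (Q : ℚ) (Q^[1+n]≢1 : ∀ n → Q ^ suc n ≢ 1ℚ) where

  [_]! : ℕ → ℚ
  [ n ]! = poch Q Q n

  [n]!≢0 : ∀ n → [ n ]! ≢ 0ℚ
  [n]!≢0 = poch-≢0 Q Q (λ n QQ^n≡1 → Q^[1+n]≢1 n (trans (ℚP.*-comm (Q ^ n) Q) QQ^n≡1))

  gauss-above : ∀ {n k} → n ℕ.< k → gauss Q n k ≡ 0ℚ
  gauss-above {n} {k} n<k with k ℕ.≤? n
  ... | yes k≤n = ⊥-elim (ℕP.<⇒≱ n<k k≤n)
  ... | no _ = refl

  gauss-factorial : ∀ {a b n} → a ℕ.+ b ≡ n → [ a ]! * [ b ]! * gauss Q n a ≡ [ n ]!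
  gauss-factorial {a} {b} refl with a ℕ.≤? a ℕ.+ b
  ... | no a≰a+b = ⊥-elim (a≰a+b (ℕP.m≤m+n a b))
  ... | yes _ rewrite ℕP.m+n∸m≡n a b = begin
    D * (N * inv D)  ≡⟨ swap D N (inv D) ⟩
    N * (D * inv D)  ≡⟨ cong (N *_) (x*inv[x]≡1 (*-≢0 ([n]!≢0 a) ([n]!≢0 b))) ⟩
    N * 1ℚ           ≡⟨ ℚP.*-identityʳ N ⟩
    N                ∎
    where
    D = [ a ]! * [ b ]!
    N = [ a ℕ.+ b ]!
    swap : ∀ x y z → x * (y * z) ≡ y * (x * z)
    swap = solve-∀ ℚ-ring

  gauss-unique : ∀ {a b n} r → a ℕ.+ b ≡ n → [ a ]! * [ b ]! * r ≡ [ n ]! → gauss Q n a ≡ r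
  gauss-unique {a} {b} r a+b≡n r-factorial =
    *-cancelˡ-≢0 (*-≢0 ([n]!≢0 a) ([n]!≢0 b)) (trans (gauss-factorial {a} {b} a+b≡n) (sym r-factorial))

  gauss-col0 : ∀ n → gauss Q n 0 ≡ 1ℚ
  gauss-col0 n = gauss-unique {0} {n} 1ℚ refl (trans (ℚP.*-identityʳ _) (ℚP.*-identityˡ _))

  gauss-diag : ∀ n → gauss Q n n ≡ 1ℚ
  gauss-diag n = gauss-unique {n} {0} 1ℚ (ℕP.+-identityʳ n) (trans (ℚP.*-identityʳ _) (ℚP.*-identityʳ _))

  pascalˡ-interior : ∀ {a b n} → a ℕ.+ suc b ≡ n →
    gauss Q (suc n) (suc a) ≡ gauss Q n a + Q ^ suc a * gauss Q n (suc a)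
  pascalˡ-interior {a} {b} refl = gauss-unique {suc a} {suc b} _ refl (begin
    [ suc a ]! * [ suc b ]! * (g₀ + Q ^ suc a * g₁)
      ≡⟨ regroup Q (Q ^ a) (Q ^ b) [ a ]! [ b ]! g₀ g₁ ⟩
    (1ℚ - Q * Q ^ a) * ([ a ]! * [ suc b ]! * g₀)
      + Q ^ suc a * (1ℚ - Q * Q ^ b) * ([ suc a ]! * [ b ]! * g₁)
      ≡⟨ cong₂ (λ u v → (1ℚ - Q * Q ^ a) * u + Q ^ suc a * (1ℚ - Q * Q ^ b) * v)
           (gauss-factorial {a} {suc b} refl) (gauss-factorial {suc a} {b} (sym (ℕP.+-suc a b))) ⟩
    (1ℚ - Q * Q ^ a) * N + Q ^ suc a * (1ℚ - Q * Q ^ b) * N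
      ≡⟨ collect Q (Q ^ a) (Q ^ b) N ⟩
    N * (1ℚ - Q * (Q ^ a * Q ^ suc b))
      ≡⟨ cong (λ t → N * (1ℚ - Q * t)) (^-distribˡ-+-* Q a (suc b)) ⟨
    [ suc (a ℕ.+ suc b) ]! ∎)
    where
    N  = [ a ℕ.+ suc b ]!
    g₀ = gauss Q (a ℕ.+ suc b) a
    g₁ = gauss Q (a ℕ.+ suc b) (suc a)
    regroup : ∀ Q Qᵃ Qᵇ Fᵃ Fᵇ g₀ g₁ →
      Fᵃ * (1ℚ - Q * Qᵃ) * (Fᵇ * (1ℚ - Q * Qᵇ)) * (g₀ + Qᵃ * Q * g₁)
        ≡ (1ℚ - Q * Qᵃ) * (Fᵃ * (Fᵇ * (1ℚ - Q * Qᵇ)) * g₀)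
          + Qᵃ * Q * (1ℚ - Q * Qᵇ) * (Fᵃ * (1ℚ - Q * Qᵃ) * Fᵇ * g₁)
    regroup = solve-∀ ℚ-ring
    collect : ∀ Q Qᵃ Qᵇ N →
      (1ℚ - Q * Qᵃ) * N + Qᵃ * Q * (1ℚ - Q * Qᵇ) * N ≡ N * (1ℚ - Q * (Qᵃ * (Qᵇ * Q)))
    collect = solve-∀ ℚ-ring

  pascalʳ-interior : ∀ {a b n} → a ℕ.+ suc b ≡ n →
    gauss Q (suc n) (suc a) ≡ Q ^ (n ℕ.∸ a) * gauss Q n a + gauss Q n (suc a)
  pascalʳ-interior {a} {b} refl rewrite ℕP.m+n∸m≡n a (suc b) = gauss-unique {suc a} {suc b} _ refl (begin
    [ suc a ]! * [ suc b ]! * (Q ^ suc b * g₀ + g₁)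
      ≡⟨ regroup Q (Q ^ a) (Q ^ b) [ a ]! [ b ]! g₀ g₁ ⟩
    Q ^ suc b * (1ℚ - Q * Q ^ a) * ([ a ]! * [ suc b ]! * g₀)
      + (1ℚ - Q * Q ^ b) * ([ suc a ]! * [ b ]! * g₁)
      ≡⟨ cong₂ (λ u v → Q ^ suc b * (1ℚ - Q * Q ^ a) * u + (1ℚ - Q * Q ^ b) * v)
           (gauss-factorial {a} {suc b} refl) (gauss-factorial {suc a} {b} (sym (ℕP.+-suc a b))) ⟩
    Q ^ suc b * (1ℚ - Q * Q ^ a) * N + (1ℚ - Q * Q ^ b) * N
      ≡⟨ collect Q (Q ^ a) (Q ^ b) N ⟩
    N * (1ℚ - Q * (Q ^ a * Q ^ suc b))
      ≡⟨ cong (λ t → N * (1ℚ - Q * t)) (^-distribˡ-+-* Q a (suc b)) ⟨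
    [ suc (a ℕ.+ suc b) ]! ∎)
    where
    N  = [ a ℕ.+ suc b ]!
    g₀ = gauss Q (a ℕ.+ suc b) a
    g₁ = gauss Q (a ℕ.+ suc b) (suc a)
    regroup : ∀ Q Qᵃ Qᵇ Fᵃ Fᵇ g₀ g₁ →
      Fᵃ * (1ℚ - Q * Qᵃ) * (Fᵇ * (1ℚ - Q * Qᵇ)) * (Qᵇ * Q * g₀ + g₁)
        ≡ Qᵇ * Q * (1ℚ - Q * Qᵃ) * (Fᵃ * (Fᵇ * (1ℚ - Q * Qᵇ)) * g₀)
          + (1ℚ - Q * Qᵇ) * (Fᵃ * (1ℚ - Q * Qᵃ) * Fᵇ * g₁)
    regroup = solve-∀ ℚ-ring
    collect : ∀ Q Qᵃ Qᵇ N →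
      Qᵇ * Q * (1ℚ - Q * Qᵃ) * N + (1ℚ - Q * Qᵇ) * N ≡ N * (1ℚ - Q * (Qᵃ * (Qᵇ * Q)))
    collect = solve-∀ ℚ-ring

  private
    interior : ∀ {k n} → k ℕ.< n → k ℕ.+ suc (n ℕ.∸ suc k) ≡ n
    interior {k} {n} k<n = trans (ℕP.+-suc k (n ℕ.∸ suc k)) (ℕP.m+[n∸m]≡n k<n)

    x*0+y≡y : ∀ x y → x * 0ℚ + y ≡ y
    x*0+y≡y x y = trans (cong (_+ y) (ℚP.*-zeroʳ x)) (ℚP.+-identityˡ y)

    x+y*0≡x : ∀ x y → x + y * 0ℚ ≡ x
    x+y*0≡x x y = trans (cong (x +_) (ℚP.*-zeroʳ y)) (ℚP.+-identityʳ x)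

  pascalˡ : ∀ n k → gauss Q (suc n) (suc k) ≡ gauss Q n k + Q ^ suc k * gauss Q n (suc k)
  pascalˡ n k with ℕP.<-cmp k n
  ... | tri< k<n _ _ = pascalˡ-interior (interior k<n)
  ... | tri≈ _ refl _ = begin
    gauss Q (suc n) (suc n)           ≡⟨ gauss-diag (suc n) ⟩
    1ℚ                                ≡⟨ x+y*0≡x 1ℚ (Q ^ suc n) ⟨
    1ℚ + Q ^ suc n * 0ℚ
      ≡⟨ cong₂ (λ u v → u + Q ^ suc n * v) (gauss-diag n) (gauss-above (ℕP.n<1+n n)) ⟨
    gauss Q n n + Q ^ suc n * gauss Q n (suc n) ∎
  ... | tri> _ _ n<k = begin
    gauss Q (suc n) (suc k)           ≡⟨ gauss-above (ℕ.s≤s n<k) ⟩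
    0ℚ                                ≡⟨ x+y*0≡x 0ℚ (Q ^ suc k) ⟨
    0ℚ + Q ^ suc k * 0ℚ
      ≡⟨ cong₂ (λ u v → u + Q ^ suc k * v) (gauss-above n<k) (gauss-above (ℕP.m<n⇒m<1+n n<k)) ⟨
    gauss Q n k + Q ^ suc k * gauss Q n (suc k) ∎

  pascalʳ : ∀ n k → gauss Q (suc n) (suc k) ≡ Q ^ (n ℕ.∸ k) * gauss Q n k + gauss Q n (suc k)
  pascalʳ n k with ℕP.<-cmp k n
  ... | tri< k<n _ _ = pascalʳ-interior (interior k<n)
  ... | tri≈ _ refl _ = begin
    gauss Q (suc n) (suc n)           ≡⟨ gauss-diag (suc n) ⟩
    1ℚ                                ≡⟨ ℚP.*-identityʳ 1ℚ ⟨
    Q ^ 0 * 1ℚ                        ≡⟨ cong (λ m → Q ^ m * 1ℚ) (ℕP.n∸n≡0 n) ⟨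
    Q ^ (n ℕ.∸ n) * 1ℚ                ≡⟨ ℚP.+-identityʳ _ ⟨
    Q ^ (n ℕ.∸ n) * 1ℚ + 0ℚ
      ≡⟨ cong₂ (λ u v → Q ^ (n ℕ.∸ n) * u + v) (gauss-diag n) (gauss-above (ℕP.n<1+n n)) ⟨
    Q ^ (n ℕ.∸ n) * gauss Q n n + gauss Q n (suc n) ∎
  ... | tri> _ _ n<k = begin
    gauss Q (suc n) (suc k)           ≡⟨ gauss-above (ℕ.s≤s n<k) ⟩
    0ℚ                                ≡⟨ x*0+y≡y (Q ^ (n ℕ.∸ k)) 0ℚ ⟨
    Q ^ (n ℕ.∸ k) * 0ℚ + 0ℚ
      ≡⟨ cong₂ (λ u v → Q ^ (n ℕ.∸ k) * u + v) (gauss-above n<k) (gauss-above (ℕP.m<n⇒m<1+n n<k)) ⟨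
    Q ^ (n ℕ.∸ k) * gauss Q n k + gauss Q n (suc k) ∎

  private
    weight-shift : ∀ n k → Q ^ (n ℕ.∸ k) * Q ^ suc k * gauss Q n (suc k) ≡ Q ^ suc n * gauss Q n (suc k)
    weight-shift n k with ℕP.≤-<-connex (suc k) n
    ... | inj₁ k<n = cong (_* gauss Q n (suc k)) (begin
      Q ^ (n ℕ.∸ k) * Q ^ suc k  ≡⟨ ^-distribˡ-+-* Q (n ℕ.∸ k) (suc k) ⟨
      Q ^ (n ℕ.∸ k ℕ.+ suc k)
        ≡⟨ cong (Q ^_) (trans (ℕP.+-suc (n ℕ.∸ k) k) (cong suc (ℕP.m∸n+n≡m (ℕP.<⇒≤ k<n)))) ⟩
      Q ^ suc n                  ∎)
    ... | inj₂ n<1+k rewrite gauss-above n<1+k =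
      trans (ℚP.*-zeroʳ (Q ^ (n ℕ.∸ k) * Q ^ suc k)) (sym (ℚP.*-zeroʳ (Q ^ suc n)))

  gauss-step2 : ∀ n k → gauss Q (suc (suc n)) (suc (suc k))
    ≡ Q ^ suc (suc k) * gauss Q n (suc (suc k)) + (1ℚ + Q ^ suc n) * gauss Q n (suc k)
      + Q ^ (n ℕ.∸ k) * gauss Q n k
  gauss-step2 n k = begin
    gauss Q (suc (suc n)) (suc (suc k))
      ≡⟨ pascalʳ (suc n) (suc k) ⟩
    Q ^ (n ℕ.∸ k) * gauss Q (suc n) (suc k) + gauss Q (suc n) (suc (suc k))
      ≡⟨ cong₂ (λ u v → Q ^ (n ℕ.∸ k) * u + v) (pascalˡ n k) (pascalˡ n (suc k)) ⟩
    Q ^ (n ℕ.∸ k) * (g₀ + Q ^ suc k * g₁) + (g₁ + Q ^ suc (suc k) * g₂)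
      ≡⟨ regroup (Q ^ (n ℕ.∸ k)) (Q ^ suc k) (Q ^ suc (suc k)) g₀ g₁ g₂ ⟩
    Q ^ suc (suc k) * g₂ + (g₁ + Q ^ (n ℕ.∸ k) * Q ^ suc k * g₁) + Q ^ (n ℕ.∸ k) * g₀
      ≡⟨ cong (λ t → Q ^ suc (suc k) * g₂ + (g₁ + t) + Q ^ (n ℕ.∸ k) * g₀) (weight-shift n k) ⟩
    Q ^ suc (suc k) * g₂ + (g₁ + Q ^ suc n * g₁) + Q ^ (n ℕ.∸ k) * g₀
      ≡⟨ cong (λ t → Q ^ suc (suc k) * g₂ + t + Q ^ (n ℕ.∸ k) * g₀) (factor g₁ (Q ^ suc n)) ⟩
    Q ^ suc (suc k) * g₂ + (1ℚ + Q ^ suc n) * g₁ + Q ^ (n ℕ.∸ k) * g₀ ∎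
    where
    g₀ = gauss Q n k
    g₁ = gauss Q n (suc k)
    g₂ = gauss Q n (suc (suc k))
    regroup : ∀ a b c g₀ g₁ g₂ → a * (g₀ + b * g₁) + (g₁ + c * g₂) ≡ c * g₂ + (g₁ + a * b * g₁) + a * g₀
    regroup = solve-∀ ℚ-ring
    factor : ∀ g y → g + y * g ≡ (1ℚ + y) * g
    factor = solve-∀ ℚ-ring

  gauss-step2-col1 : ∀ n → gauss Q (suc (suc n)) 1 ≡ Q ^ 1 * gauss Q n 1 + (1ℚ + Q ^ suc n) * gauss Q n 0
  gauss-step2-col1 n = begin
    gauss Q (suc (suc n)) 1
      ≡⟨ pascalʳ (suc n) 0 ⟩
    Q ^ suc n * gauss Q (suc n) 0 + gauss Q (suc n) 1
      ≡⟨ cong₂ (λ u v → Q ^ suc n * u + v) (trans (gauss-col0 (suc n)) (sym (gauss-col0 n))) (pascalˡ n 0) ⟩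
    Q ^ suc n * gauss Q n 0 + (gauss Q n 0 + Q ^ 1 * gauss Q n 1)
      ≡⟨ regroup (Q ^ suc n) (Q ^ 1) (gauss Q n 0) (gauss Q n 1) ⟩
    Q ^ 1 * gauss Q n 1 + (1ℚ + Q ^ suc n) * gauss Q n 0 ∎
    where
    regroup : ∀ a b g₀ g₁ → a * g₀ + (g₀ + b * g₁) ≡ b * g₁ + (1ℚ + a) * g₀
    regroup = solve-∀ ℚ-ring

+-suc² : ∀ m n → m ℕ.+ suc (suc n) ≡ suc (suc (m ℕ.+ n))
+-suc² m n = trans (ℕP.+-suc m (suc n)) (cong suc (ℕP.+-suc m n))

∣m⊖n∣≡∣m-n∣ : ∀ m n → ℤ.∣ m ⊖ n ∣ ≡ ∣ m - n ∣
∣m⊖n∣≡∣m-n∣ zero zero = refl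
∣m⊖n∣≡∣m-n∣ zero (suc n) = refl
∣m⊖n∣≡∣m-n∣ (suc m) zero = refl
∣m⊖n∣≡∣m-n∣ (suc m) (suc n) = trans (cong ℤ.∣_∣ (ℤP.[1+m]⊖[1+n]≡m⊖n m n)) (∣m⊖n∣≡∣m-n∣ m n)

-- (k + 1 - L)² = (k - L)² + 2(k - L) + 1, with both sides moved so that no subtraction occurs.
∣1+k-L∣²-step : ∀ k L → suc (2 ℕ.* L) ℕ.+ ∣ suc k - L ∣ ℕ.* ∣ suc k - L ∣ ≡ ∣ k - L ∣ ℕ.* ∣ k - L ∣ ℕ.+ 2 ℕ.* suc k
∣1+k-L∣²-step zero zero = refl
∣1+k-L∣²-step zero (suc L) = square L
  where
  square : ∀ L → suc (2 ℕ.* suc L) ℕ.+ L ℕ.* L ≡ suc L ℕ.* suc L ℕ.+ 2 ℕ.* 1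
  square = ℕS.solve-∀
∣1+k-L∣²-step (suc k) zero = square k
  where
  square : ∀ k → suc (2 ℕ.* 0) ℕ.+ suc (suc k) ℕ.* suc (suc k) ≡ suc k ℕ.* suc k ℕ.+ 2 ℕ.* suc (suc k)
  square = ℕS.solve-∀
∣1+k-L∣²-step (suc k) (suc L) = begin
  suc (2 ℕ.* suc L) ℕ.+ e′            ≡⟨ shift L e′ ⟩
  2 ℕ.+ (suc (2 ℕ.* L) ℕ.+ e′)        ≡⟨ cong (2 ℕ.+_) (∣1+k-L∣²-step k L) ⟩
  2 ℕ.+ (e ℕ.+ 2 ℕ.* suc k)           ≡⟨ unshift e k ⟩
  e ℕ.+ 2 ℕ.* suc (suc k)             ∎
  where
  e  = ∣ k - L ∣ ℕ.* ∣ k - L ∣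
  e′ = ∣ suc k - L ∣ ℕ.* ∣ suc k - L ∣
  shift : ∀ L e′ → suc (2 ℕ.* suc L) ℕ.+ e′ ≡ 2 ℕ.+ (suc (2 ℕ.* L) ℕ.+ e′)
  shift = ℕS.solve-∀
  unshift : ∀ e k → 2 ℕ.+ (e ℕ.+ 2 ℕ.* suc k) ≡ e ℕ.+ 2 ℕ.* suc (suc k)
  unshift = ℕS.solve-∀

∣1+k-L∣²-step′ : ∀ k L → k ℕ.≤ 2 ℕ.* L →
  suc (2 ℕ.* L) ℕ.+ ∣ k - L ∣ ℕ.* ∣ k - L ∣ ≡ ∣ suc k - L ∣ ℕ.* ∣ suc k - L ∣ ℕ.+ 2 ℕ.* (2 ℕ.* L ℕ.∸ k)
∣1+k-L∣²-step′ k L k≤2L =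
  swap {k} {2 ℕ.* L ℕ.∸ k} (cong suc (ℕP.m+[n∸m]≡n k≤2L)) (∣1+k-L∣²-step k L)
  where
  swap : ∀ {k m n e e′} → suc (k ℕ.+ m) ≡ n → n ℕ.+ e′ ≡ e ℕ.+ 2 ℕ.* suc k → n ℕ.+ e ≡ e′ ℕ.+ 2 ℕ.* m
  swap {k} {m} {n} {e} {e′} refl step = ℕP.+-cancelʳ-≡ (2 ℕ.* suc k) _ _ (begin
    n ℕ.+ e ℕ.+ 2 ℕ.* suc k      ≡⟨ ℕP.+-assoc n e (2 ℕ.* suc k) ⟩
    n ℕ.+ (e ℕ.+ 2 ℕ.* suc k)    ≡⟨ cong (n ℕ.+_) step ⟨
    n ℕ.+ (n ℕ.+ e′)             ≡⟨ rearrange k m e′ ⟩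
    e′ ℕ.+ 2 ℕ.* m ℕ.+ 2 ℕ.* suc k ∎)
    where
    rearrange : ∀ k m e′ → suc (k ℕ.+ m) ℕ.+ (suc (k ℕ.+ m) ℕ.+ e′) ≡ e′ ℕ.+ 2 ℕ.* m ℕ.+ 2 ℕ.* suc k
    rearrange = ℕS.solve-∀

[-1]^∣1+k-L∣ : ∀ k L → (- 1ℚ) ^ ∣ suc k - L ∣ ≡ - (- 1ℚ) ^ ∣ k - L ∣
[-1]^∣1+k-L∣ zero zero = refl
[-1]^∣1+k-L∣ zero (suc L) = flip ((- 1ℚ) ^ L)
  where
  flip : ∀ s → s ≡ - (s * - 1ℚ)
  flip = solve-∀ ℚ-ring
[-1]^∣1+k-L∣ (suc k) zero = flip ((- 1ℚ) ^ suc k)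
  where
  flip : ∀ s → s * - 1ℚ ≡ - s
  flip = solve-∀ ℚ-ring
[-1]^∣1+k-L∣ (suc k) (suc L) = [-1]^∣1+k-L∣ k L

residue-symbol : ℕ → ℚ
residue-symbol 1 = 1ℚ
residue-symbol 2 = - 1ℚ
residue-symbol _ = 0ℚ

leg3≡residue-symbol : ∀ z → leg3 z ≡ residue-symbol (z %ℕ 3)
leg3≡residue-symbol z with z %ℕ 3
... | 0 = refl
... | 1 = refl
... | 2 = refl
... | suc (suc (suc _)) = refl

neg-residue : ℕ → ℕ
neg-residue zero = zero
neg-residue (suc r) = 3 ℕ.∸ suc r

-[1+n]%ℕ3 : ∀ n → -[1+ n ] %ℕ 3 ≡ neg-residue (suc n ℕ.% 3)
-[1+n]%ℕ3 n with suc n ℕ.% 3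
... | zero = refl
... | suc r = refl

[3+n]%3≡n%3 : ∀ n → (3 ℕ.+ n) ℕ.% 3 ≡ n ℕ.% 3
[3+n]%3≡n%3 n = trans (cong (ℕ._% 3) (ℕP.+-comm 3 n)) (ℕD.[m+n]%n≡m%n n 3)

[z+3]%ℕ3≡z%ℕ3 : ∀ z → (z ℤ.+ ℤ.+ 3) %ℕ 3 ≡ z %ℕ 3
[z+3]%ℕ3≡z%ℕ3 (ℤ.+ n) = ℕD.[m+n]%n≡m%n n 3
[z+3]%ℕ3≡z%ℕ3 -[1+ 0 ] = refl
[z+3]%ℕ3≡z%ℕ3 -[1+ 1 ] = refl
[z+3]%ℕ3≡z%ℕ3 -[1+ 2 ] = refl
[z+3]%ℕ3≡z%ℕ3 -[1+ suc (suc (suc m)) ] = begin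
  -[1+ m ] %ℕ 3                              ≡⟨ -[1+n]%ℕ3 m ⟩
  neg-residue (suc m ℕ.% 3)                  ≡⟨ cong neg-residue ([3+n]%3≡n%3 (suc m)) ⟨
  neg-residue (suc (suc (suc (suc m))) ℕ.% 3) ≡⟨ -[1+n]%ℕ3 (suc (suc (suc m))) ⟨
  -[1+ suc (suc (suc m)) ] %ℕ 3              ∎

leg3-periodic : ∀ z → leg3 (z ℤ.+ ℤ.+ 3) ≡ leg3 z
leg3-periodic z = begin
  leg3 (z ℤ.+ ℤ.+ 3)                        ≡⟨ leg3≡residue-symbol (z ℤ.+ ℤ.+ 3) ⟩
  residue-symbol ((z ℤ.+ ℤ.+ 3) %ℕ 3)       ≡⟨ cong residue-symbol ([z+3]%ℕ3≡z%ℕ3 z) ⟩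
  residue-symbol (z %ℕ 3)                   ≡⟨ leg3≡residue-symbol z ⟨
  leg3 z                                    ∎

χ : ℕ → ℚ
χ n = leg3 (ℤ.+ n)

χ-periodic : ∀ n → χ (3 ℕ.+ n) ≡ χ n
χ-periodic n = trans (cong χ (ℕP.+-comm 3 n)) (leg3-periodic (ℤ.+ n))

χ[3m+1]≡1 : ∀ m → χ (m ℕ.* 3 ℕ.+ 1) ≡ 1ℚ
χ[3m+1]≡1 zero = refl
χ[3m+1]≡1 (suc m) = trans (χ-periodic (m ℕ.* 3 ℕ.+ 1)) (χ[3m+1]≡1 m)

χ-neighbours : ∀ n → χ n + χ (2 ℕ.+ n) ≡ - χ (suc n)
χ-neighbours 0 = refl
χ-neighbours 1 = refl
χ-neighbours 2 = refl
χ-neighbours (suc (suc (suc n)))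
  rewrite χ-periodic n | χ-periodic (suc n) | χ-periodic (suc (suc n)) = χ-neighbours n

χ-kernel : ∀ x n → - x * χ n + (1ℚ + x * x) * χ (suc n) + - x * χ (suc (suc n)) ≡ (1ℚ + x + x * x) * χ (suc n)
χ-kernel x n = begin
  - x * χ n + (1ℚ + x * x) * χ (suc n) + - x * χ (suc (suc n))  ≡⟨ split x (χ n) (χ (suc n)) (χ (suc (suc n))) ⟩
  - x * (χ n + χ (suc (suc n))) + (1ℚ + x * x) * χ (suc n)
    ≡⟨ cong (λ t → - x * t + (1ℚ + x * x) * χ (suc n)) (χ-neighbours n) ⟩
  - x * - χ (suc n) + (1ℚ + x * x) * χ (suc n)                   ≡⟨ combine x (χ (suc n)) ⟩
  (1ℚ + x + x * x) * χ (suc n)                                   ∎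
  where
  split : ∀ x c₀ c₁ c₂ → - x * c₀ + (1ℚ + x * x) * c₁ + - x * c₂ ≡ - x * (c₀ + c₂) + (1ℚ + x * x) * c₁
  split = solve-∀ ℚ-ring
  combine : ∀ x c → - x * - c + (1ℚ + x * x) * c ≡ (1ℚ + x + x * x) * c
  combine = solve-∀ ℚ-ring

leg3[a⊖L]≡χ[a+2L] : ∀ a L → leg3 (a ⊖ L) ≡ χ (a ℕ.+ 2 ℕ.* L)
leg3[a⊖L]≡χ[a+2L] a zero = cong χ (sym (ℕP.+-identityʳ a))
leg3[a⊖L]≡χ[a+2L] a (suc L) = begin
  leg3 (a ⊖ suc L)                      ≡⟨ leg3-periodic (a ⊖ suc L) ⟨
  leg3 (a ⊖ suc L ℤ.+ ℤ.+ 3)            ≡⟨ cong leg3 (ℤP.distribˡ-⊖-+-pos 3 a (suc L)) ⟩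
  leg3 ((a ℕ.+ 3) ⊖ suc L)              ≡⟨ cong (λ t → leg3 (t ⊖ suc L)) (ℕP.+-comm a 3) ⟩
  leg3 (suc (suc (suc a)) ⊖ suc L)      ≡⟨ cong leg3 (ℤP.[1+m]⊖[1+n]≡m⊖n (suc (suc a)) L) ⟩
  leg3 (suc (suc a) ⊖ L)                ≡⟨ leg3[a⊖L]≡χ[a+2L] (suc (suc a)) L ⟩
  χ (suc (suc a) ℕ.+ 2 ℕ.* L)           ≡⟨ cong χ (shift a L) ⟩
  χ (a ℕ.+ 2 ℕ.* suc L)                 ∎
  where
  shift : ∀ a L → suc (suc a) ℕ.+ 2 ℕ.* L ≡ a ℕ.+ 2 ℕ.* suc L
  shift = ℕS.solve-∀

module Theta (q : ℚ) (q^[1+n]≢1 : ∀ n → q ^ suc n ≢ 1ℚ) where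

  open Gaussian (q ^ 2) (λ n → q^[1+n]≢1 (n ℕ.+ 1 ℕ.* suc n) ∘ trans (sym (^-*-assoc q 2 (suc n))))

  x : ℕ → ℚ
  x L = q ^ suc (2 ℕ.* L)

  sgn : ℕ → ℕ → ℚ
  sgn L k = (- 1ℚ) ^ ∣ k - L ∣

  wt : ℕ → ℕ → ℚ
  wt L k = q ^ (∣ k - L ∣ ℕ.* ∣ k - L ∣)

  θ : ℕ → ℕ → ℚ
  θ L k = sgn L k * wt L k * gauss (q ^ 2) (2 ℕ.* L) k

  q^-split : ∀ a b c d → a ℕ.+ b ≡ c ℕ.+ 2 ℕ.* d → q ^ a * q ^ b ≡ q ^ c * (q ^ 2) ^ d
  q^-split a b c d a+b≡c+2d = begin
    q ^ a * q ^ b            ≡⟨ ^-distribˡ-+-* q a b ⟨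
    q ^ (a ℕ.+ b)            ≡⟨ cong (q ^_) a+b≡c+2d ⟩
    q ^ (c ℕ.+ 2 ℕ.* d)      ≡⟨ ^-distribˡ-+-* q c (2 ℕ.* d) ⟩
    q ^ c * q ^ (2 ℕ.* d)    ≡⟨ cong (q ^ c *_) (^-*-assoc q 2 d) ⟨
    q ^ c * (q ^ 2) ^ d      ∎

  x²≡[q²]^[1+2L] : ∀ L → x L * x L ≡ (q ^ 2) ^ suc (2 ℕ.* L)
  x²≡[q²]^[1+2L] L = trans (q^-split n n 0 n (cong (n ℕ.+_) (sym (ℕP.+-identityʳ n))))
                           (ℚP.*-identityˡ ((q ^ 2) ^ n))
    where n = suc (2 ℕ.* L)

  x*wt-raise : ∀ L k → x L * wt L (suc k) ≡ wt L k * (q ^ 2) ^ suc k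
  x*wt-raise L k =
    q^-split (suc (2 ℕ.* L)) (∣ suc k - L ∣ ℕ.* ∣ suc k - L ∣) (∣ k - L ∣ ℕ.* ∣ k - L ∣) (suc k)
      (∣1+k-L∣²-step k L)

  x*wt-lower : ∀ L k → x L * wt L k * gauss (q ^ 2) (2 ℕ.* L) k
                      ≡ wt L (suc k) * (q ^ 2) ^ (2 ℕ.* L ℕ.∸ k) * gauss (q ^ 2) (2 ℕ.* L) k
  x*wt-lower L k with ℕP.≤-<-connex k (2 ℕ.* L)
  ... | inj₁ k≤2L = cong (_* gauss (q ^ 2) (2 ℕ.* L) k) 
    (q^-split (suc (2 ℕ.* L)) (∣ k - L ∣ ℕ.* ∣ k - L ∣) (∣ suc k - L ∣ ℕ.* ∣ suc k - L ∣) (2 ℕ.* L ℕ.∸ k)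
      (∣1+k-L∣²-step′ k L k≤2L))
  ... | inj₂ 2L<k rewrite gauss-above 2L<k =
    trans (ℚP.*-zeroʳ (x L * wt L k)) (sym (ℚP.*-zeroʳ (wt L (suc k) * (q ^ 2) ^ (2 ℕ.* L ℕ.∸ k))))

  θ-raise : ∀ L k → sgn L k * wt L k * ((q ^ 2) ^ suc k * gauss (q ^ 2) (2 ℕ.* L) (suc k))
                    ≡ - x L * θ L (suc k)
  θ-raise L k = begin
    s * wt L k * (Qᵏ * g)          ≡⟨ regroup s (wt L k) Qᵏ g ⟩
    s * (wt L k * Qᵏ) * g          ≡⟨ cong (λ t → s * t * g) (x*wt-raise L k) ⟨
    s * (x L * wt L (suc k)) * g   ≡⟨ pull s (x L) (wt L (suc k)) g ⟩
    - x L * (- s * wt L (suc k) * g) ≡⟨ cong (λ t → - x L * (t * wt L (suc k) * g)) ([-1]^∣1+k-L∣ k L) ⟨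
    - x L * θ L (suc k)            ∎
    where
    s  = sgn L k
    Qᵏ = (q ^ 2) ^ suc k
    g  = gauss (q ^ 2) (2 ℕ.* L) (suc k)
    regroup : ∀ s w Q g → s * w * (Q * g) ≡ s * (w * Q) * g
    regroup = solve-∀ ℚ-ring
    pull : ∀ s x w g → s * (x * w) * g ≡ - x * (- s * w * g)
    pull = solve-∀ ℚ-ring

  θ-lower : ∀ L k → sgn L (suc k) * wt L (suc k) * ((q ^ 2) ^ (2 ℕ.* L ℕ.∸ k) * gauss (q ^ 2) (2 ℕ.* L) k)
                    ≡ - x L * θ L k
  θ-lower L k = begin
    s′ * wt L (suc k) * (Qᵈ * g)         ≡⟨ regroup s′ (wt L (suc k)) Qᵈ g ⟩
    s′ * (wt L (suc k) * Qᵈ * g)         ≡⟨ cong (s′ *_) (x*wt-lower L k) ⟨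
    s′ * (x L * wt L k * g)              ≡⟨ pull s′ (x L) (wt L k) g ⟩
    - x L * (- s′ * wt L k * g)          ≡⟨ cong (λ t → - x L * (t * wt L k * g)) -s′≡s ⟩
    - x L * θ L k                        ∎
    where
    s′ = sgn L (suc k)
    Qᵈ = (q ^ 2) ^ (2 ℕ.* L ℕ.∸ k)
    g  = gauss (q ^ 2) (2 ℕ.* L) k
    -s′≡s : - s′ ≡ sgn L k
    -s′≡s = trans (cong -_ ([-1]^∣1+k-L∣ k L)) (+-Group.⁻¹-involutive (sgn L k))
    regroup : ∀ s w Q g → s * w * (Q * g) ≡ s * (w * Q * g)
    regroup = solve-∀ ℚ-ring
    pull : ∀ s x w g → s * (x * w * g) ≡ - x * (- s * w * g)
    pull = solve-∀ ℚ-ring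

  gauss-top-suc : ∀ L k → gauss (q ^ 2) (2 ℕ.* suc L) k ≡ gauss (q ^ 2) (suc (suc (2 ℕ.* L))) k
  gauss-top-suc L k = cong (λ n → gauss (q ^ 2) n k) (ℕP.*-suc 2 L)

  wt[1+L]0≡x*wt : ∀ L → wt (suc L) 0 ≡ x L * wt L 0
  wt[1+L]0≡x*wt L = begin
    q ^ (suc L ℕ.* suc L)                ≡⟨ cong (q ^_) (square L) ⟨
    q ^ (suc (2 ℕ.* L) ℕ.+ L ℕ.* L)      ≡⟨ ^-distribˡ-+-* q (suc (2 ℕ.* L)) (L ℕ.* L) ⟩
    x L * q ^ (L ℕ.* L)                  ∎
    where
    square : ∀ L → suc (2 ℕ.* L) ℕ.+ L ℕ.* L ≡ suc L ℕ.* suc L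
    square = ℕS.solve-∀

  θ-step : ∀ L k → θ (suc L) k ≡ conv3 (- x L) (1ℚ + x L * x L) (θ L) k
  θ-step L zero = begin
    sgn L 0 * - 1ℚ * wt (suc L) 0 * gauss (q ^ 2) (2 ℕ.* suc L) 0
      ≡⟨ cong₂ (λ w g → sgn L 0 * - 1ℚ * w * g) (wt[1+L]0≡x*wt L)
           (trans (gauss-col0 (2 ℕ.* suc L)) (sym (gauss-col0 (2 ℕ.* L)))) ⟩
    sgn L 0 * - 1ℚ * (x L * wt L 0) * gauss (q ^ 2) (2 ℕ.* L) 0
      ≡⟨ pull (sgn L 0) (x L) (wt L 0) (gauss (q ^ 2) (2 ℕ.* L) 0) ⟩
    - x L * θ L 0 ∎
    where
    pull : ∀ s x w g → s * - 1ℚ * (x * w) * g ≡ - x * (s * w * g)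
    pull = solve-∀ ℚ-ring
  θ-step L (suc zero) = begin
    S * gauss (q ^ 2) (2 ℕ.* suc L) 1
      ≡⟨ cong (S *_) (trans (gauss-top-suc L 1) (gauss-step2-col1 (2 ℕ.* L))) ⟩
    S * ((q ^ 2) ^ 1 * g₁ + (1ℚ + (q ^ 2) ^ suc (2 ℕ.* L)) * g₀)
      ≡⟨ cong (λ t → S * ((q ^ 2) ^ 1 * g₁ + (1ℚ + t) * g₀)) (x²≡[q²]^[1+2L] L) ⟨
    S * ((q ^ 2) ^ 1 * g₁ + (1ℚ + x L * x L) * g₀)
      ≡⟨ distrib S ((q ^ 2) ^ 1 * g₁) (1ℚ + x L * x L) g₀ ⟩
    S * ((q ^ 2) ^ 1 * g₁) + (1ℚ + x L * x L) * (S * g₀)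
      ≡⟨ cong (_+ (1ℚ + x L * x L) * θ L 0) (θ-raise L 0) ⟩
    - x L * θ L 1 + (1ℚ + x L * x L) * θ L 0 ∎
    where
    S  = sgn L 0 * wt L 0
    g₀ = gauss (q ^ 2) (2 ℕ.* L) 0
    g₁ = gauss (q ^ 2) (2 ℕ.* L) 1
    distrib : ∀ S a b g → S * (a + b * g) ≡ S * a + b * (S * g)
    distrib = solve-∀ ℚ-ring
  θ-step L (suc (suc k)) = begin
    S * gauss (q ^ 2) (2 ℕ.* suc L) (suc (suc k))
      ≡⟨ cong (S *_) (trans (gauss-top-suc L (suc (suc k))) (gauss-step2 (2 ℕ.* L) k)) ⟩
    S * (Qᵏ * g₂ + (1ℚ + (q ^ 2) ^ suc (2 ℕ.* L)) * g₁ + Qᵈ * g₀)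
      ≡⟨ cong (λ t → S * (Qᵏ * g₂ + (1ℚ + t) * g₁ + Qᵈ * g₀)) (x²≡[q²]^[1+2L] L) ⟨
    S * (Qᵏ * g₂ + (1ℚ + x L * x L) * g₁ + Qᵈ * g₀)
      ≡⟨ distrib S (Qᵏ * g₂) (1ℚ + x L * x L) g₁ (Qᵈ * g₀) ⟩
    S * (Qᵏ * g₂) + (1ℚ + x L * x L) * (S * g₁) + S * (Qᵈ * g₀)
      ≡⟨ cong₂ (λ u v → u + (1ℚ + x L * x L) * θ L (suc k) + v) (θ-raise L (suc k)) (θ-lower L k) ⟩
    - x L * θ L (suc (suc k)) + (1ℚ + x L * x L) * θ L (suc k) + - x L * θ L k ∎
    where
    S  = sgn L (suc k) * wt L (suc k)
    Qᵏ = (q ^ 2) ^ suc (suc k)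
    Qᵈ = (q ^ 2) ^ (2 ℕ.* L ℕ.∸ k)
    g₀ = gauss (q ^ 2) (2 ℕ.* L) k
    g₁ = gauss (q ^ 2) (2 ℕ.* L) (suc k)
    g₂ = gauss (q ^ 2) (2 ℕ.* L) (suc (suc k))
    distrib : ∀ S a b g c → S * (a + b * g + c) ≡ S * a + b * (S * g) + S * c
    distrib = solve-∀ ℚ-ring

  θ-above : ∀ L k → 2 ℕ.* L ℕ.< k → θ L k ≡ 0ℚ
  θ-above L k 2L<k = trans (cong (sgn L k * wt L k *_) (gauss-above 2L<k)) (ℚP.*-zeroʳ (sgn L k * wt L k))

  Π₃ : ℕ → ℚ
  Π₃ zero = 1ℚ
  Π₃ (suc L) = Π₃ L * (1ℚ + x L + x L * x L)

  Θ : ℕ → ℕ → ℚ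
  Θ L s = Σ< (suc (2 ℕ.* L)) (λ k → θ L k * χ (k ℕ.+ s))

  Θ-step : ∀ L s → Θ (suc L) s ≡ - x L * Θ L s + (1ℚ + x L * x L) * Θ L (suc s) + - x L * Θ L (suc (suc s))
  Θ-step L s = begin
    Σ< (suc (2 ℕ.* suc L)) (λ k → θ (suc L) k * c k)
      ≡⟨ cong (λ m → Σ< (suc m) (λ k → θ (suc L) k * c k)) (ℕP.*-suc 2 L) ⟩
    Σ< (3 ℕ.+ n) (λ k → θ (suc L) k * c k)
      ≡⟨ Σ<-cong (3 ℕ.+ n) (λ k → cong (_* c k) (θ-step L k)) ⟩
    Σ< (3 ℕ.+ n) (λ k → conv3 α β (θ L) k * c k)
      ≡⟨ Σ<-conv3 α β (θ L) c (suc n) ⟩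
    α * Σ< (3 ℕ.+ n) (λ k → θ L k * c k) + β * Σ< (2 ℕ.+ n) (λ k → θ L k * c (suc k))
      + α * Σ< (suc n) (λ k → θ L k * c (suc (suc k)))
      ≡⟨ cong₂ (λ u v → α * u + β * v + α * Σ< (suc n) (λ k → θ L k * c (suc (suc k))))
           (Σ<-vanishing-tail (suc n) _ (θ*c-above c) 2) (Σ<-vanishing-tail (suc n) _ (θ*c-above (c ∘ suc)) 1) ⟩
    α * Θ L s + β * Σ< (suc n) (λ k → θ L k * c (suc k)) + α * Σ< (suc n) (λ k → θ L k * c (suc (suc k)))
      ≡⟨ cong₂ (λ u v → α * Θ L s + β * u + α * v)
           (Σ<-cong (suc n) (λ k → cong (λ t → θ L k * χ t) (sym (ℕP.+-suc k s))))
           (Σ<-cong (suc n) (λ k → cong (λ t → θ L k * χ t) (sym (+-suc² k s)))) ⟩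
    α * Θ L s + β * Θ L (suc s) + α * Θ L (suc (suc s)) ∎
    where
    n = 2 ℕ.* L
    α = - x L
    β = 1ℚ + x L * x L
    c : ℕ → ℚ
    c k = χ (k ℕ.+ s)
    θ*c-above : ∀ (c : ℕ → ℚ) k → suc n ℕ.≤ k → θ L k * c k ≡ 0ℚ
    θ*c-above c k n<k = trans (cong (_* c k) (θ-above L k n<k)) (ℚP.*-zeroˡ (c k))

  Θ≡Π₃*χ : ∀ L s → Θ L s ≡ Π₃ L * χ (L ℕ.+ s)
  Θ≡Π₃*χ zero s = begin
    0ℚ + sgn 0 0 * wt 0 0 * gauss (q ^ 2) 0 0 * χ s  ≡⟨ cong (λ g → 0ℚ + 1ℚ * 1ℚ * g * χ s) (gauss-col0 0) ⟩
    0ℚ + 1ℚ * 1ℚ * 1ℚ * χ s                          ≡⟨ simplify (χ s) ⟩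
    1ℚ * χ s                                          ∎
    where
    simplify : ∀ c → 0ℚ + 1ℚ * 1ℚ * 1ℚ * c ≡ 1ℚ * c
    simplify = solve-∀ ℚ-ring
  Θ≡Π₃*χ (suc L) s = begin
    Θ (suc L) s
      ≡⟨ Θ-step L s ⟩
    α * Θ L s + β * Θ L (suc s) + α * Θ L (suc (suc s))
      ≡⟨ cong₂ _+_ (cong₂ (λ u v → α * u + β * v) (Θ≡Π₃*χ L s) (Θ≡Π₃*χ L (suc s)))
                   (cong (α *_) (Θ≡Π₃*χ L (suc (suc s)))) ⟩
    α * (P * χ y) + β * (P * χ (L ℕ.+ suc s)) + α * (P * χ (L ℕ.+ suc (suc s)))
      ≡⟨ cong₂ (λ u v → α * (P * χ y) + β * (P * χ u) + α * (P * χ v)) (ℕP.+-suc L s) (+-suc² L s) ⟩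
    α * (P * χ y) + β * (P * χ (suc y)) + α * (P * χ (suc (suc y)))
      ≡⟨ factor P α β (χ y) (χ (suc y)) (χ (suc (suc y))) ⟩
    P * (α * χ y + β * χ (suc y) + α * χ (suc (suc y)))
      ≡⟨ cong (P *_) (χ-kernel (x L) y) ⟩
    P * ((1ℚ + x L + x L * x L) * χ (suc y))
      ≡⟨ ℚP.*-assoc P (1ℚ + x L + x L * x L) (χ (suc y)) ⟨
    Π₃ (suc L) * χ (suc y) ∎
    where
    P = Π₃ L
    α = - x L
    β = 1ℚ + x L * x L
    y = L ℕ.+ s
    factor : ∀ P a b c₀ c₁ c₂ → a * (P * c₀) + b * (P * c₁) + a * (P * c₂) ≡ P * (a * c₀ + b * c₁ + a * c₂)
    factor = solve-∀ ℚ-ring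

  q*[q²]^L≡x : ∀ L → q * (q ^ 2) ^ L ≡ x L
  q*[q²]^L≡x L = begin
    q * (q ^ 2) ^ L      ≡⟨ cong (q *_) (^-*-assoc q 2 L) ⟩
    q * q ^ (2 ℕ.* L)    ≡⟨ ℚP.*-comm q (q ^ (2 ℕ.* L)) ⟩
    x L                  ∎

  q³*[q⁶]^L≡x³ : ∀ L → q ^ 3 * (q ^ 6) ^ L ≡ x L * x L * x L
  q³*[q⁶]^L≡x³ L = begin
    q ^ 3 * (q ^ 6) ^ L          ≡⟨ cong (q ^ 3 *_) (^-*-assoc q 6 L) ⟩
    q ^ 3 * q ^ (6 ℕ.* L)        ≡⟨ ^-distribˡ-+-* q 3 (6 ℕ.* L) ⟨
    q ^ (3 ℕ.+ 6 ℕ.* L)          ≡⟨ cong (q ^_) (thrice L) ⟩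
    q ^ (m ℕ.+ m ℕ.+ m)          ≡⟨ ^-distribˡ-+-* q (m ℕ.+ m) m ⟩
    q ^ (m ℕ.+ m) * x L          ≡⟨ cong (_* x L) (^-distribˡ-+-* q m m) ⟩
    x L * x L * x L              ∎
    where
    m = suc (2 ℕ.* L)
    thrice : ∀ L → 3 ℕ.+ 6 ℕ.* L ≡ suc (2 ℕ.* L) ℕ.+ suc (2 ℕ.* L) ℕ.+ suc (2 ℕ.* L)
    thrice = ℕS.solve-∀

  Π₃*poch≡poch : ∀ L → Π₃ L * poch q (q ^ 2) L ≡ poch (q ^ 3) (q ^ 6) L
  Π₃*poch≡poch zero = refl
  Π₃*poch≡poch (suc L) = begin
    Π₃ L * (1ℚ + x L + x L * x L) * (poch q (q ^ 2) L * (1ℚ - q * (q ^ 2) ^ L))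
      ≡⟨ cong (λ t → Π₃ L * (1ℚ + x L + x L * x L) * (poch q (q ^ 2) L * (1ℚ - t))) (q*[q²]^L≡x L) ⟩
    Π₃ L * (1ℚ + x L + x L * x L) * (poch q (q ^ 2) L * (1ℚ - x L))
      ≡⟨ cube (Π₃ L) (poch q (q ^ 2) L) (x L) ⟩
    Π₃ L * poch q (q ^ 2) L * (1ℚ - x L * x L * x L)
      ≡⟨ cong₂ (λ u v → u * (1ℚ - v)) (Π₃*poch≡poch L) (sym (q³*[q⁶]^L≡x³ L)) ⟩
    poch (q ^ 3) (q ^ 6) L * (1ℚ - q ^ 3 * (q ^ 6) ^ L) ∎
    where
    cube : ∀ P p x → P * (1ℚ + x + x * x) * (p * (1ℚ - x)) ≡ P * p * (1ℚ - x * x * x)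
    cube = solve-∀ ℚ-ring

  Π₃≡poch/poch : ∀ L → Π₃ L ≡ poch (q ^ 3) (q ^ 6) L * inv (poch q (q ^ 2) L)
  Π₃≡poch/poch L = *-cancelˡ-≢0 p≢0 (begin
    p * Π₃ L            ≡⟨ ℚP.*-comm p (Π₃ L) ⟩
    Π₃ L * p            ≡⟨ Π₃*poch≡poch L ⟩
    r                   ≡⟨ ℚP.*-identityʳ r ⟨
    r * 1ℚ              ≡⟨ cong (r *_) (x*inv[x]≡1 p≢0) ⟨
    r * (p * inv p)     ≡⟨ swap r p (inv p) ⟩
    p * (r * inv p)     ∎)
    where
    p = poch q (q ^ 2) L
    r = poch (q ^ 3) (q ^ 6) L
    p≢0 : p ≢ 0ℚ
    p≢0 = poch-≢0 q (q ^ 2) (λ n → q^[1+n]≢1 (2 ℕ.* n) ∘ trans (sym (q*[q²]^L≡x n))) L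
    swap : ∀ x y z → x * (y * z) ≡ y * (x * z)
    swap = solve-∀ ℚ-ring

  term≡θ*χ : ∀ L k → term q L (ℤ.- (ℤ.+ L) ℤ.+ ℤ.+ k) ≡ θ L k * χ (k ℕ.+ suc (2 ℕ.* L))
  term≡θ*χ L k = begin
    (- 1ℚ) ^ ℤ.∣ j ∣ * q ^ (ℤ.∣ j ∣ ℕ.* ℤ.∣ j ∣) * leg3 (j ℤ.+ ℤ.+ 1) * qbin2 q (2 ℕ.* L) (ℤ.+ L ℤ.+ j)
      ≡⟨ cong (λ d → (- 1ℚ) ^ d * q ^ (d ℕ.* d) * leg3 (j ℤ.+ ℤ.+ 1) * qbin2 q (2 ℕ.* L) (ℤ.+ L ℤ.+ j)) ∣j∣≡∣k-L∣ ⟩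
    sgn L k * wt L k * leg3 (j ℤ.+ ℤ.+ 1) * qbin2 q (2 ℕ.* L) (ℤ.+ L ℤ.+ j)
      ≡⟨ cong₂ (λ u v → sgn L k * wt L k * u * v) leg3[j+1]≡χ qbin2≡gauss′ ⟩
    sgn L k * wt L k * χ (k ℕ.+ suc (2 ℕ.* L)) * gauss (q ^ 2) (2 ℕ.* L) k
      ≡⟨ swap (sgn L k * wt L k) (χ (k ℕ.+ suc (2 ℕ.* L))) (gauss (q ^ 2) (2 ℕ.* L) k) ⟩
    θ L k * χ (k ℕ.+ suc (2 ℕ.* L)) ∎
    where
    j = ℤ.- (ℤ.+ L) ℤ.+ ℤ.+ k
    j≡k⊖L : j ≡ k ⊖ L
    j≡k⊖L = ℤP.-m+n≡n⊖m L k
    ∣j∣≡∣k-L∣ : ℤ.∣ j ∣ ≡ ∣ k - L ∣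
    ∣j∣≡∣k-L∣ = trans (cong ℤ.∣_∣ j≡k⊖L) (∣m⊖n∣≡∣m-n∣ k L)
    leg3[j+1]≡χ : leg3 (j ℤ.+ ℤ.+ 1) ≡ χ (k ℕ.+ suc (2 ℕ.* L))
    leg3[j+1]≡χ = begin
      leg3 (j ℤ.+ ℤ.+ 1)           ≡⟨ cong (λ t → leg3 (t ℤ.+ ℤ.+ 1)) j≡k⊖L ⟩
      leg3 (k ⊖ L ℤ.+ ℤ.+ 1)       ≡⟨ cong leg3 (ℤP.distribˡ-⊖-+-pos 1 k L) ⟩
      leg3 ((k ℕ.+ 1) ⊖ L)         ≡⟨ leg3[a⊖L]≡χ[a+2L] (k ℕ.+ 1) L ⟩
      χ (k ℕ.+ 1 ℕ.+ 2 ℕ.* L)      ≡⟨ cong χ (ℕP.+-assoc k 1 (2 ℕ.* L)) ⟩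
      χ (k ℕ.+ suc (2 ℕ.* L))      ∎
    L+j≡k : ℤ.+ L ℤ.+ j ≡ ℤ.+ k
    L+j≡k = begin
      ℤ.+ L ℤ.+ (ℤ.- (ℤ.+ L) ℤ.+ ℤ.+ k)  ≡⟨ ℤP.+-assoc (ℤ.+ L) (ℤ.- (ℤ.+ L)) (ℤ.+ k) ⟨
      ℤ.+ L ℤ.- ℤ.+ L ℤ.+ ℤ.+ k          ≡⟨ cong (ℤ._+ ℤ.+ k) (ℤP.+-inverseʳ (ℤ.+ L)) ⟩
      ℤ.+ 0 ℤ.+ ℤ.+ k                    ≡⟨ ℤP.+-identityˡ (ℤ.+ k) ⟩
      ℤ.+ k                              ∎
    qbin2≡gauss′ : qbin2 q (2 ℕ.* L) (ℤ.+ L ℤ.+ j) ≡ gauss (q ^ 2) (2 ℕ.* L) k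
    qbin2≡gauss′ = trans (cong (qbin2 q (2 ℕ.* L)) L+j≡k) (qbin2≡gauss q (2 ℕ.* L) k)
    swap : ∀ a c g → a * c * g ≡ a * g * c
    swap = solve-∀ ℚ-ring

  sumSym≡Θ : ∀ L → sumSym L (term q L) ≡ Θ L (suc (2 ℕ.* L))
  sumSym≡Θ L = trans (foldr-applyUpTo≡Σ< (suc (2 ℕ.* L)) (λ i → term q L (ℤ.- (ℤ.+ L) ℤ.+ ℤ.+ i)) (λ i → i))
                     (Σ<-cong (suc (2 ℕ.* L)) (term≡θ*χ L))

theorem2p4 : (L : ℕ) (q : ℚ) → q ≢ 1ℚ → q ≢ - 1ℚ →
    sumSym L (term q L) ≡ poch (q ^ 3) (q ^ 6) L * inv (poch q (q ^ 2) L)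
theorem2p4 L q q≢1 q≢-1 = begin
  sumSym L (term q L)                   ≡⟨ sumSym≡Θ L ⟩
  Θ L (suc (2 ℕ.* L))                   ≡⟨ Θ≡Π₃*χ L (suc (2 ℕ.* L)) ⟩
  Π₃ L * χ (L ℕ.+ suc (2 ℕ.* L))        ≡⟨ cong (λ n → Π₃ L * χ n) (three-L+1 L) ⟩
  Π₃ L * χ (L ℕ.* 3 ℕ.+ 1)              ≡⟨ cong (Π₃ L *_) (χ[3m+1]≡1 L) ⟩
  Π₃ L * 1ℚ                             ≡⟨ ℚP.*-identityʳ (Π₃ L) ⟩
  Π₃ L                                  ≡⟨ Π₃≡poch/poch L ⟩
  poch (q ^ 3) (q ^ 6) L * inv (poch q (q ^ 2) L) ∎
  where
  open Theta q (x^[1+n]≢1 q≢1 q≢-1)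
  three-L+1 : ∀ L → L ℕ.+ suc (2 ℕ.* L) ≡ L ℕ.* 3 ℕ.+ 1
  three-L+1 = ℕS.solve-∀
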